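{- Let $\Phi$ be a tight derivation in system $\mathcal{N}$ of $\Gamma\vdash^{(m,e,s)} t:\sigma$. If $t\to_{dn} t'$, then there is a derivation $\Phi'$ in system $\mathcal{N}$ of $\Gamma\vdash^{(m',e',s)} t':\sigma$ such that: (1) $m'=m-1$ and $e'=e$ if the step $t\to_{dn}t'$ is an $m$-step; (2) $e'=e-1$ and $m'=m$ if the step $t\to_{dn}t'$ is an $e$-step.
   Context: Terms are $t,u,r ::= x \mid \lambda x.t \mid t\,u \mid t[x\backslash u]$ over a countably infinite set of variables, where $t[x\backslash u]$ (explicit substitution) binds $x$ in $t$; terms are taken modulo $\alpha$-conversion and $t\{x:=u\}$ is capture-avoiding meta-level substitution. List contexts are $L ::= \square \mid L[x\backslash t]$, and $L\langle t\rangle$ plugs $t$ into the hole. The deterministic CBN relation $\to_{dn}$ is the least relation closed under: $(L\langle\lambda x.t\rangle)\,u\to_{dn}L\langle t[x\backslash u]\rangle$ (an $m$-step); $t[x\backslash u]\to_{dn}t\{x:=u\}$ (an $e$-step); if $t\to_{dn}s$ and $t$ is not of the form $L\langle\lambda y.r\rangle$ then $t\,u\to_{dn}s\,u$; if $t\to_{dn}s$ then $\lambda x.t\to_{dn}\lambda x.s$. A step is an $m$-step or an $e$-step according to which of the two axioms it applies at its base. Types. Tight types: $\mathtt{tt} ::= \mathtt{n} \mid \mathtt{a}$. Types: $\sigma,\tau ::= \mathtt{tt} \mid \mathcal{M} \mid \mathcal{M}\to\sigma$, where multitypes $\mathcal{M} = [\sigma_i]_{i\in I}$ are finite multisets of types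 ($[\,]$ empty, $\sqcup$ union). A typing context $\Gamma$ maps variables to multitypes, $[\,]$ for all but finitely many; $\mathrm{dom}(\Gamma)=\{x \mid \Gamma(x)\neq[\,]\}$; $(\Gamma+\Delta)(x) = \Gamma(x)\sqcup\Delta(x)$, extended to finite sums $+_{i\in I}\Gamma_i$; $\Gamma\setminus\!\!\setminus x$ maps $x$ to $[\,]$ and agrees with $\Gamma$ elsewhere; $\Gamma; x:\mathcal{M}$ maps $x$ to $\mathcal{M}$ and agrees with $\Gamma$ elsewhere, where $x\notin\mathrm{dom}(\Gamma)$. Judgements $\Gamma \vdash^{(m,e,s)} t:\sigma$ carry natural-number counters. System $\mathcal{N}$ consists of the rules: (app$_p$) from $\Gamma\vdash^{(m,e,s)} t:\mathtt{n}$ infer $\Gamma\vdash^{(m,e,s+1)} t\,u:\mathtt{n}$; (abs$_p$) from $\Gamma\vdash^{(m,e,s)} t:\mathtt{tt}$ (a tight type) with $\Gamma(x)$ tight, infer $\Gamma\setminus\!\!\setminus x\vdash^{(m,e,s+1)}\lambda x.t:\mathtt{a}$; (var$_c$) $x:[\sigma]\vdash^{(0,0,0)} x:\sigma$; (abs$_c$) from $\Gamma\vdash^{(m,e,s)} t:\tau$ infer $\Gamma\setminus\!\!\setminus x\vdash^{(m,e,s)}\lambda x.t:\Gamma(x)\to\tau$; (app$_c$) from $\Gamma\vdash^{(m,e,s)} t:[\sigma_i]_{i\in I}\to\tau$ and $\Delta_i\vdash^{(m_i,e_i,s_i)} u:\sigma_i$ for each $i\in I$, infer $\Gamma+_{i\in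 I}\Delta_i\vdash^{(1+m+\sum_i m_i,\,1+e+\sum_i e_i,\,s+\sum_i s_i)} t\,u:\tau$; (es$_c$) from $\Gamma;x:[\sigma_i]_{i\in I}\vdash^{(m,e,s)} t:\tau$ and $\Delta_i\vdash^{(m_i,e_i,s_i)} u:\sigma_i$ for each $i\in I$, infer $(\Gamma\setminus\!\!\setminus x)+_{i\in I}\Delta_i\vdash^{(m+\sum_i m_i,\,1+e+\sum_i e_i,\,s+\sum_i s_i)} t[x\backslash u]:\tau$. A multitype is tight if all its elements are tight types; a context is tight if all multitypes it assigns are tight; a derivation of $\Gamma\vdash^{(m,e,s)} t:\sigma$ is tight if $\Gamma$ is tight and $\sigma$ is a tight type. -}

module Defs where

open import Data.Nat using (ℕ; zero; suc; _+_)
open import Data.List using (List; []; _∷_; _++_; length)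
open import Data.List.Relation.Unary.All using (All)
open import Data.List.Relation.Binary.Permutation.Homogeneous using (Permutation)
open import Data.Product using (Σ; ∃; _×_; _,_)
open import Relation.Binary.PropositionalEquality using (_≡_)
open import Relation.Nullary using (¬_)

-- Terms (de Bruijn indices: terms are taken modulo α-conversion).
-- ƛ t binds index 0 in t;  es t u  is  t[x\u]  and binds index 0 in t.

data Tm : Set where
  var : ℕ → Tm
  ƛ   : Tm → Tm
  _·_ : Tm → Tm → Tm
  es  : Tm → Tm → Tm

infixl 7 _·_

ext : (ℕ → ℕ) → ℕ → ℕ
ext ρ zero    = zero
ext ρ (suc n) = suc (ρ n)

rename : (ℕ → ℕ) → Tm → Tm
rename ρ (var x)  = var (ρ x)
rename ρ (ƛ t)    = ƛ (rename (ext ρ) t)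
rename ρ (t · u)  = rename ρ t · rename ρ u
rename ρ (es t u) = es (rename (ext ρ) t) (rename ρ u)

exts : (ℕ → Tm) → ℕ → Tm
exts σ zero    = var zero
exts σ (suc n) = rename suc (σ n)

subst : (ℕ → Tm) → Tm → Tm
subst σ (var x)  = σ x
subst σ (ƛ t)    = ƛ (subst (exts σ) t)
subst σ (t · u)  = subst σ t · subst σ u
subst σ (es t u) = es (subst (exts σ) t) (subst σ u)

-- t{x:=u} where x is the variable bound at index 0 of t
subst0 : Tm → ℕ → Tm
subst0 u zero    = u
subst0 u (suc n) = var n

_[0:=_] : Tm → Tm → Tm
t [0:= u ] = subst (subst0 u) t

data LCtx : Set where
  □    : LCtx
  _[_] : LCtx → Tm → LCtx

_⟨_⟩ : LCtx → Tm → Tm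
□ ⟨ t ⟩       = t
(L [ u ]) ⟨ t ⟩ = es (L ⟨ t ⟩) u

-- number of binders of L (needed to weaken terms moved under L)
∣_∣L : LCtx → ℕ
∣ □ ∣L       = 0
∣ L [ u ] ∣L = suc ∣ L ∣L

data Kind : Set where
  mstep estep : Kind

data _⟶[_]_ : Tm → Kind → Tm → Set where
  dB   : ∀ L t u → ((L ⟨ ƛ t ⟩) · u) ⟶[ mstep ] (L ⟨ es t (rename (∣ L ∣L +_) u) ⟩)
  sub  : ∀ t u → es t u ⟶[ estep ] (t [0:= u ])
  appL : ∀ {k t s} u → t ⟶[ k ] s → ¬ (Σ LCtx λ L → Σ Tm λ r → t ≡ L ⟨ ƛ r ⟩)
       → (t · u) ⟶[ k ] (s · u)
  lam  : ∀ {k t s} → t ⟶[ k ] s → ƛ t ⟶[ k ] ƛ s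

-- Types and multitypes (multitypes are lists up to permutation)

data Ty : Set where
  n a  : Ty
  mt   : List Ty → Ty
  _⇒_  : List Ty → Ty → Ty

infixr 5 _⇒_

MTy : Set
MTy = List Ty

mutual
  data _≈T_ : Ty → Ty → Set where
    n≈ : n ≈T n
    a≈ : a ≈T a
    mt≈ : ∀ {M M′} → M ≈M M′ → mt M ≈T mt M′
    ⇒≈ : ∀ {M M′ σ σ′} → M ≈M M′ → σ ≈T σ′ → (M ⇒ σ) ≈T (M′ ⇒ σ′)

  _≈M_ : MTy → MTy → Set
  M ≈M M′ = Permutation _≈T_ M M′

data TightTy : Ty → Set where
  n-tight : TightTy n
  a-tight : TightTy a

TightM : MTy → Set
TightM M = All TightTy M

Ctx : Set
Ctx = ℕ → MTy

∅ : Ctx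
∅ _ = []

_⊕_ : Ctx → Ctx → Ctx
(Γ ⊕ Δ) x = Γ x ++ Δ x

-- Γ \\ x  for the bound variable 0, shifted out of scope
tail : Ctx → Ctx
tail Γ x = Γ (suc x)

single : ℕ → Ty → Ctx
single zero    σ zero    = σ ∷ []
single zero    σ (suc y) = []
single (suc x) σ zero    = []
single (suc x) σ (suc y) = single x σ y

_≈C_ : Ctx → Ctx → Set
Γ ≈C Δ = ∀ x → Γ x ≈M Δ x

TightCtx : Ctx → Set
TightCtx Γ = ∀ x → TightM (Γ x)

-- Deriv Γ t σ m e s  is the type of derivations of Γ ⊢^(m,e,s) t : σ.
-- Args u M Δ m e s : a family of derivations Δᵢ ⊢^(mᵢ,eᵢ,sᵢ) u : σᵢ for M = [σᵢ],
-- with Δ = +ᵢ Δᵢ and (m,e,s) = Σᵢ (mᵢ,eᵢ,sᵢ).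

mutual
  data Deriv : Ctx → Tm → Ty → ℕ → ℕ → ℕ → Set where
    app-p : ∀ {Γ t u m e s} → Deriv Γ t n m e s → Deriv Γ (t · u) n m e (suc s)
    abs-p : ∀ {Γ Γ′ t τ m e s} → Deriv Γ t τ m e s → TightTy τ → TightM (Γ 0)
          → Γ′ ≈C tail Γ → Deriv Γ′ (ƛ t) a m e (suc s)
    var-c : ∀ {Γ′ x σ} → Γ′ ≈C single x σ → Deriv Γ′ (var x) σ 0 0 0
    abs-c : ∀ {Γ Γ′ t τ m e s} → Deriv Γ t τ m e s
          → Γ′ ≈C tail Γ → Deriv Γ′ (ƛ t) (Γ 0 ⇒ τ) m e s
    app-c : ∀ {Γ Δ Γ′ t u M L τ m e s mᵢ eᵢ sᵢ}
          → Deriv Γ t (M ⇒ τ) m e s → Args u L Δ mᵢ eᵢ sᵢ → L ≈M M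
          → Γ′ ≈C (Γ ⊕ Δ)
          → Deriv Γ′ (t · u) τ (suc (m + mᵢ)) (suc (e + eᵢ)) (s + sᵢ)
    es-c  : ∀ {Γ Δ Γ′ t u L τ m e s mᵢ eᵢ sᵢ}
          → Deriv Γ t τ m e s → Args u L Δ mᵢ eᵢ sᵢ → L ≈M Γ 0
          → Γ′ ≈C (tail Γ ⊕ Δ)
          → Deriv Γ′ (es t u) τ (m + mᵢ) (suc (e + eᵢ)) (s + sᵢ)

  data Args (u : Tm) : MTy → Ctx → ℕ → ℕ → ℕ → Set where
    []  : Args u [] ∅ 0 0 0
    _∷_ : ∀ {Δ Δs σ L m e s ms es ss}
        → Deriv Δ u σ m e s → Args u L Δs ms es ss
        → Args u (σ ∷ L) (Δ ⊕ Δs) (m + ms) (e + es) (s + ss)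

Counters : Kind → ℕ → ℕ → ℕ → ℕ → Set
Counters mstep m e m′ e′ = m ≡ suc m′ × e′ ≡ e
Counters estep m e m′ e′ = e ≡ suc e′ × m′ ≡ m

{-# OPTIONS --safe #-}
module Submission where

-- An e-step t[x\u] → t{x:=u} is the substitution
-- lemma: the derivations of u for the multitype of x are spliced into the axioms for x, so the
-- counters of t and u add up and only the e of the erased es-c rule is lost. An m-step
-- (L⟨λx.t⟩)u → L⟨t[x\u]⟩ turns the app-c rule into an es-c rule under L, losing one m.

open import Defs
open import Algebra.Bundles using (CommutativeMonoid)
import Algebra.Construct.Pointwise as Pointwise
import Algebra.Properties.CommutativeSemigroup as CommutativeSemigroupProperties
open import Data.Nat using (ℕ; zero; suc; _+_)
open import Data.Nat.Properties using (+-assoc; +-identityʳ; +-commutativeSemigroup)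
open import Data.List using ([]; _∷_; _++_)
open import Data.List.Relation.Binary.Pointwise using (Pointwise; []; _∷_)
open import Data.List.Relation.Binary.Permutation.Homogeneous using (refl; prep; swap; trans)
open import Data.Product using (Σ; _×_; _,_)
open import Data.Empty using (⊥-elim)
open import Relation.Nullary using (¬_)
open import Relation.Binary.Bundles using (Setoid)
import Relation.Binary.Reasoning.Setoid as SetoidReasoning
open import Relation.Binary.PropositionalEquality as ≡ using (_≡_; cong)

private variable
  Γ Γ′ Δ Δ′ : Ctx
  t u : Tm
  σ σ′ τ : Ty
  M M′ N : MTy
  m e s m′ e′ s′ : ℕ

mutual
  ≈T-refl : ∀ σ → σ ≈T σ
  ≈T-refl n       = n≈
  ≈T-refl a       = a≈
  ≈T-refl (mt M)  = mt≈ (≈M-refl M)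
  ≈T-refl (M ⇒ σ) = ⇒≈ (≈M-refl M) (≈T-refl σ)

  ≈M-refl : ∀ M → M ≈M M
  ≈M-refl M = refl (≈T-pointwise-refl M)

  ≈T-pointwise-refl : ∀ M → Pointwise _≈T_ M M
  ≈T-pointwise-refl []      = []
  ≈T-pointwise-refl (σ ∷ M) = ≈T-refl σ ∷ ≈T-pointwise-refl M

mutual
  ≈T-sym : σ ≈T τ → τ ≈T σ
  ≈T-sym n≈       = n≈
  ≈T-sym a≈       = a≈
  ≈T-sym (mt≈ p)  = mt≈ (≈M-sym p)
  ≈T-sym (⇒≈ p q) = ⇒≈ (≈M-sym p) (≈T-sym q)

  ≈M-sym : M ≈M N → N ≈M M
  ≈M-sym (refl p)     = refl (≈T-pointwise-sym p)
  ≈M-sym (prep p q)   = prep (≈T-sym p) (≈M-sym q)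
  ≈M-sym (swap p q r) = swap (≈T-sym q) (≈T-sym p) (≈M-sym r)
  ≈M-sym (trans p q)  = trans (≈M-sym q) (≈M-sym p)

  ≈T-pointwise-sym : Pointwise _≈T_ M N → Pointwise _≈T_ N M
  ≈T-pointwise-sym []      = []
  ≈T-pointwise-sym (p ∷ q) = ≈T-sym p ∷ ≈T-pointwise-sym q

≈T-trans : ∀ {ρ} → σ ≈T τ → τ ≈T ρ → σ ≈T ρ
≈T-trans n≈       n≈         = n≈
≈T-trans a≈       a≈         = a≈
≈T-trans (mt≈ p)  (mt≈ p′)   = mt≈ (trans p p′)
≈T-trans (⇒≈ p q) (⇒≈ p′ q′) = ⇒≈ (trans p p′) (≈T-trans q q′)

≈T-setoid : Setoid _ _
≈T-setoid = record
  { Carrier       = Ty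
  ; _≈_           = _≈T_
  ; isEquivalence = record { refl = ≈T-refl _ ; sym = ≈T-sym ; trans = ≈T-trans }
  }

open import Data.List.Relation.Binary.Permutation.Setoid ≈T-setoid
  using (↭-sym; ↭-trans; ↭-reflexive)
open import Data.List.Relation.Binary.Permutation.Setoid.Properties ≈T-setoid
  using (++-identityʳ; ++-commutativeMonoid; xs↭ys⇒|xs|≡|ys|)

⊕-commutativeMonoid : CommutativeMonoid _ _
⊕-commutativeMonoid = Pointwise.commutativeMonoid ℕ ++-commutativeMonoid

open CommutativeMonoid ⊕-commutativeMonoid using ()
  renaming ( refl to ≈C-refl; sym to ≈C-sym; trans to ≈C-trans; ∙-cong to ⊕-cong; assoc to ⊕-assoc
           ; identityʳ to ⊕-identityʳ; commutativeSemigroup to ⊕-commutativeSemigroup )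
module ≈C-Reasoning = SetoidReasoning (CommutativeMonoid.setoid ⊕-commutativeMonoid)
open CommutativeSemigroupProperties ⊕-commutativeSemigroup using ()
  renaming (interchange to ⊕-interchange; x∙yz≈y∙xz to ⊕-leftComm; xy∙z≈xz∙y to ⊕-rightComm)
open CommutativeSemigroupProperties +-commutativeSemigroup using ()
  renaming (interchange to +-interchange; x∙yz≈y∙xz to +-leftComm; xy∙z≈xz∙y to +-rightComm)

Deriv-cast : m ≡ m′ → e ≡ e′ → s ≡ s′ → Deriv Γ t σ m e s → Deriv Γ t σ m′ e′ s′
Deriv-cast ≡.refl ≡.refl ≡.refl d = d

Args-cast : m ≡ m′ → e ≡ e′ → s ≡ s′ → Args u M Δ m e s → Args u M Δ m′ e′ s′
Args-cast ≡.refl ≡.refl ≡.refl as = as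

Deriv-resp-≈C : Deriv Γ t σ m e s → Γ ≈C Γ′ → Deriv Γ′ t σ m e s
Deriv-resp-≈C (app-p d)         p = app-p (Deriv-resp-≈C d p)
Deriv-resp-≈C (abs-p d tτ tM q) p = abs-p d tτ tM (≈C-trans (≈C-sym p) q)
Deriv-resp-≈C (var-c q)         p = var-c (≈C-trans (≈C-sym p) q)
Deriv-resp-≈C (abs-c d q)       p = abs-c d (≈C-trans (≈C-sym p) q)
Deriv-resp-≈C (app-c d as r q)  p = app-c d as r (≈C-trans (≈C-sym p) q)
Deriv-resp-≈C (es-c d as r q)   p = es-c d as r (≈C-trans (≈C-sym p) q)

setHead : MTy → Ctx → Ctx
setHead M Γ zero    = M
setHead M Γ (suc x) = Γ (suc x)

≈C-setHead : Γ 0 ≈M M → Γ ≈C setHead M Γ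
≈C-setHead p zero    = p
≈C-setHead p (suc x) = ≈M-refl _

abs-c-≈ : Deriv Γ t τ m e s → Γ 0 ≈M M → Γ′ ≈C tail Γ → Deriv Γ′ (ƛ t) (M ⇒ τ) m e s
abs-c-≈ d p q = abs-c (Deriv-resp-≈C d (≈C-setHead p)) q

abs-p-≈ : Deriv Γ t τ m e s → TightTy τ → TightM M → Γ 0 ≈M M → Γ′ ≈C tail Γ
        → Deriv Γ′ (ƛ t) a m e (suc s)
abs-p-≈ d tτ tM p q = abs-p (Deriv-resp-≈C d (≈C-setHead p)) tτ tM q

single-resp-≈T : ∀ x → σ ≈T σ′ → single x σ ≈C single x σ′
single-resp-≈T zero    p zero    = prep p (≈M-refl [])
single-resp-≈T zero    p (suc y) = ≈M-refl []
single-resp-≈T (suc x) p zero    = ≈M-refl []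
single-resp-≈T (suc x) p (suc y) = single-resp-≈T x p y

Deriv-resp-≈T : Deriv Γ t σ m e s → σ ≈T σ′ → Deriv Γ t σ′ m e s
Deriv-resp-≈T (app-p d)               n≈       = app-p d
Deriv-resp-≈T (abs-p d tτ tM q)       a≈       = abs-p d tτ tM q
Deriv-resp-≈T (var-c {x = x} q)       p        = var-c (≈C-trans q (single-resp-≈T x p))
Deriv-resp-≈T (abs-c d q)             (⇒≈ p r) = abs-c-≈ (Deriv-resp-≈T d r) p q
Deriv-resp-≈T (app-c {M = M} d as r q) p       = app-c (Deriv-resp-≈T d (⇒≈ (≈M-refl M) p)) as r q
Deriv-resp-≈T (es-c d as r q)         p        = es-c (Deriv-resp-≈T d p) as r q

-- Args is indexed by the exact sum of its contexts, which a rearrangement can only preserve up to ≈C.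
ArgsUpTo : Tm → MTy → Ctx → ℕ → ℕ → ℕ → Set
ArgsUpTo u M Δ m e s = Σ Ctx λ Δ′ → Args u M Δ′ m e s × Δ′ ≈C Δ

Args-resp-Pointwise : Args u M Δ m e s → Pointwise _≈T_ M N → Args u N Δ m e s
Args-resp-Pointwise []        []       = []
Args-resp-Pointwise (d ∷ as) (p ∷ ps) = Deriv-resp-≈T d p ∷ Args-resp-Pointwise as ps

Args-resp-≈M : Args u M Δ m e s → M ≈M N → ArgsUpTo u N Δ m e s
Args-resp-≈M as (refl ps) = _ , Args-resp-Pointwise as ps , ≈C-refl
Args-resp-≈M (d ∷ as) (prep p ps) with Args-resp-≈M as ps
... | _ , as′ , q = _ , Deriv-resp-≈T d p ∷ as′ , ⊕-cong ≈C-refl q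
Args-resp-≈M (_∷_ {Δ = Δ₁} {m = m₁} {e = e₁} {s = s₁} d₁
               (_∷_ {Δ = Δ₂} {Δs = Δs} {m = m₂} {e = e₂} {s = s₂} d₂ as)) (swap p₁ p₂ ps)
  with Args-resp-≈M as ps
... | _ , as′ , q =
  _ , Args-cast (+-leftComm m₂ m₁ _) (+-leftComm e₂ e₁ _) (+-leftComm s₂ s₁ _)
        (Deriv-resp-≈T d₂ p₂ ∷ (Deriv-resp-≈T d₁ p₁ ∷ as′))
    , ≈C-trans (⊕-cong (≈C-refl {Δ₂}) (⊕-cong (≈C-refl {Δ₁}) q)) (⊕-leftComm Δ₂ Δ₁ Δs)
Args-resp-≈M as (trans ps qs) with Args-resp-≈M as ps
... | _ , as₁ , q₁ with Args-resp-≈M as₁ qs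
... | _ , as₂ , q₂ = _ , as₂ , ≈C-trans q₂ q₁

≈M-[]-inv : M ≈M [] → M ≡ []
≈M-[]-inv {[]}    p = ≡.refl
≈M-[]-inv {_ ∷ _} p with xs↭ys⇒|xs|≡|ys| p
... | ()

record ArgsSplit (u : Tm) (M N : MTy) (Δ : Ctx) (m e s : ℕ) : Set where
  constructor argsSplit
  field
    {Δ₁ Δ₂}             : Ctx
    {m₁ e₁ s₁ m₂ e₂ s₂} : ℕ
    args₁ : Args u M Δ₁ m₁ e₁ s₁
    args₂ : Args u N Δ₂ m₂ e₂ s₂
    ctx≈  : Δ ≈C (Δ₁ ⊕ Δ₂)
    m≡    : m ≡ m₁ + m₂
    e≡    : e ≡ e₁ + e₂
    s≡    : s ≡ s₁ + s₂

Args-split : ∀ M → Args u (M ++ N) Δ m e s → ArgsSplit u M N Δ m e s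
Args-split []      as = argsSplit [] as ≈C-refl ≡.refl ≡.refl ≡.refl
Args-split (σ ∷ M) (_∷_ {Δ = Δ} {m = m} {e = e} {s = s} d as) with Args-split M as
... | argsSplit {Δ₁} {Δ₂} as₁ as₂ q m≡ e≡ s≡ =
  argsSplit (d ∷ as₁) as₂ (≈C-trans (⊕-cong (≈C-refl {Δ}) q) (≈C-sym (⊕-assoc Δ Δ₁ Δ₂)))
    (≡.trans (cong (m +_) m≡) (≡.sym (+-assoc m _ _)))
    (≡.trans (cong (e +_) e≡) (≡.sym (+-assoc e _ _)))
    (≡.trans (cong (s +_) s≡) (≡.sym (+-assoc s _ _)))

Args-split-≈M : ∀ M → Args u N Δ m e s → N ≈M (M ++ M′) → ArgsSplit u M M′ Δ m e s
Args-split-≈M M as p with Args-resp-≈M as p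
... | _ , as′ , q with Args-split M as′
... | argsSplit as₁ as₂ q′ m≡ e≡ s≡ = argsSplit as₁ as₂ (≈C-trans (≈C-sym q) q′) m≡ e≡ s≡

≗⇒≈C : (∀ x → Γ x ≡ Δ x) → Γ ≈C Δ
≗⇒≈C p x = ↭-reflexive (p x)

shiftCtx : ℕ → Ctx → Ctx
shiftCtx zero    Γ y       = Γ y
shiftCtx (suc k) Γ zero    = []
shiftCtx (suc k) Γ (suc y) = shiftCtx k Γ y

weakenCtx : ℕ → ℕ → Ctx → Ctx
weakenCtx zero    k Γ y       = shiftCtx k Γ y
weakenCtx (suc c) k Γ zero    = Γ zero
weakenCtx (suc c) k Γ (suc y) = weakenCtx c k (tail Γ) y

weakenVar : ℕ → ℕ → ℕ → ℕ
weakenVar zero    k x       = k + x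
weakenVar (suc c) k zero    = zero
weakenVar (suc c) k (suc x) = suc (weakenVar c k x)

shiftCtx-resp-≈C : ∀ k → Γ ≈C Δ → shiftCtx k Γ ≈C shiftCtx k Δ
shiftCtx-resp-≈C zero    p y       = p y
shiftCtx-resp-≈C (suc k) p zero    = ≈M-refl []
shiftCtx-resp-≈C (suc k) p (suc y) = shiftCtx-resp-≈C k p y

weakenCtx-resp-≈C : ∀ c k → Γ ≈C Δ → weakenCtx c k Γ ≈C weakenCtx c k Δ
weakenCtx-resp-≈C zero    k p y       = shiftCtx-resp-≈C k p y
weakenCtx-resp-≈C (suc c) k p zero    = p zero
weakenCtx-resp-≈C (suc c) k p (suc y) = weakenCtx-resp-≈C c k (λ x → p (suc x)) y

shiftCtx-⊕ : ∀ k Γ Δ y → shiftCtx k (Γ ⊕ Δ) y ≡ (shiftCtx k Γ ⊕ shiftCtx k Δ) y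
shiftCtx-⊕ zero    Γ Δ y       = ≡.refl
shiftCtx-⊕ (suc k) Γ Δ zero    = ≡.refl
shiftCtx-⊕ (suc k) Γ Δ (suc y) = shiftCtx-⊕ k Γ Δ y

weakenCtx-⊕ : ∀ c k Γ Δ y → weakenCtx c k (Γ ⊕ Δ) y ≡ (weakenCtx c k Γ ⊕ weakenCtx c k Δ) y
weakenCtx-⊕ zero    k Γ Δ y       = shiftCtx-⊕ k Γ Δ y
weakenCtx-⊕ (suc c) k Γ Δ zero    = ≡.refl
weakenCtx-⊕ (suc c) k Γ Δ (suc y) = weakenCtx-⊕ c k (tail Γ) (tail Δ) y

shiftCtx-∅ : ∀ k y → shiftCtx k ∅ y ≡ []
shiftCtx-∅ zero    y       = ≡.refl
shiftCtx-∅ (suc k) zero    = ≡.refl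
shiftCtx-∅ (suc k) (suc y) = shiftCtx-∅ k y

weakenCtx-∅ : ∀ c k y → weakenCtx c k ∅ y ≡ []
weakenCtx-∅ zero    k y       = shiftCtx-∅ k y
weakenCtx-∅ (suc c) k zero    = ≡.refl
weakenCtx-∅ (suc c) k (suc y) = weakenCtx-∅ c k y

shiftCtx-single : ∀ k x σ y → shiftCtx k (single x σ) y ≡ single (k + x) σ y
shiftCtx-single zero    x σ y       = ≡.refl
shiftCtx-single (suc k) x σ zero    = ≡.refl
shiftCtx-single (suc k) x σ (suc y) = shiftCtx-single k x σ y

weakenCtx-single : ∀ c k x σ y → weakenCtx c k (single x σ) y ≡ single (weakenVar c k x) σ y
weakenCtx-single zero    k x       σ y       = shiftCtx-single k x σ y
weakenCtx-single (suc c) k zero    σ zero    = ≡.refl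
weakenCtx-single (suc c) k (suc x) σ zero    = ≡.refl
weakenCtx-single (suc c) k zero    σ (suc y) = weakenCtx-∅ c k y
weakenCtx-single (suc c) k (suc x) σ (suc y) = weakenCtx-single c k x σ y

weakenCtx-⊕-resp : ∀ c k {Γ₁ Γ₂} → Γ ≈C (Γ₁ ⊕ Γ₂) → Δ ≈C weakenCtx c k Γ₂
                 → weakenCtx c k Γ ≈C (weakenCtx c k Γ₁ ⊕ Δ)
weakenCtx-⊕-resp {Γ} {Δ} c k {Γ₁} {Γ₂} p q = begin
  weakenCtx c k Γ                           ≈⟨ weakenCtx-resp-≈C c k p ⟩
  weakenCtx c k (Γ₁ ⊕ Γ₂)                   ≈⟨ ≗⇒≈C (weakenCtx-⊕ c k Γ₁ Γ₂) ⟩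
  weakenCtx c k Γ₁ ⊕ weakenCtx c k Γ₂       ≈⟨ ⊕-cong (≈C-refl {weakenCtx c k Γ₁}) q ⟨
  weakenCtx c k Γ₁ ⊕ Δ                      ∎
  where open ≈C-Reasoning

ext-weakenVar : ∀ {ρ c k} → (∀ x → ρ x ≡ weakenVar c k x) → ∀ x → ext ρ x ≡ weakenVar (suc c) k x
ext-weakenVar ρ≗ zero    = ≡.refl
ext-weakenVar ρ≗ (suc x) = cong suc (ρ≗ x)

mutual
  Deriv-weaken : ∀ c k {ρ} → (∀ x → ρ x ≡ weakenVar c k x)
               → Deriv Γ t σ m e s → Deriv (weakenCtx c k Γ) (rename ρ t) σ m e s
  Deriv-weaken c k ρ≗ (app-p d) = app-p (Deriv-weaken c k ρ≗ d)
  Deriv-weaken c k ρ≗ (abs-p d tτ tM q) =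
    abs-p (Deriv-weaken (suc c) k (ext-weakenVar ρ≗) d) tτ tM (weakenCtx-resp-≈C c k q)
  Deriv-weaken c k ρ≗ (var-c {x = x} {σ = σ} q) rewrite ρ≗ x =
    var-c (≈C-trans (weakenCtx-resp-≈C c k q) (≗⇒≈C (weakenCtx-single c k x σ)))
  Deriv-weaken c k ρ≗ (abs-c d q) =
    abs-c (Deriv-weaken (suc c) k (ext-weakenVar ρ≗) d) (weakenCtx-resp-≈C c k q)
  Deriv-weaken c k ρ≗ (app-c d as r q) with Args-weaken c k ρ≗ as
  ... | _ , as′ , q′ = app-c (Deriv-weaken c k ρ≗ d) as′ r (weakenCtx-⊕-resp c k q q′)
  Deriv-weaken c k ρ≗ (es-c d as r q) with Args-weaken c k ρ≗ as
  ... | _ , as′ , q′ = es-c (Deriv-weaken (suc c) k (ext-weakenVar ρ≗) d) as′ r (weakenCtx-⊕-resp c k q q′)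

  Args-weaken : ∀ c k {ρ} → (∀ x → ρ x ≡ weakenVar c k x)
              → Args u M Δ m e s → ArgsUpTo (rename ρ u) M (weakenCtx c k Δ) m e s
  Args-weaken c k ρ≗ [] = ∅ , [] , ≗⇒≈C (λ y → ≡.sym (weakenCtx-∅ c k y))
  Args-weaken c k ρ≗ (d ∷ as) with Args-weaken c k ρ≗ as
  ... | _ , as′ , q = _ , Deriv-weaken c k ρ≗ d ∷ as′ , ≈C-sym (weakenCtx-⊕-resp c k ≈C-refl q)

dropCtx : ℕ → Ctx → Ctx
dropCtx zero    Γ y       = Γ (suc y)
dropCtx (suc c) Γ zero    = Γ zero
dropCtx (suc c) Γ (suc y) = dropCtx c (tail Γ) y

dropCtx-resp-≈C : ∀ c → Γ ≈C Δ → dropCtx c Γ ≈C dropCtx c Δ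
dropCtx-resp-≈C zero    p y       = p (suc y)
dropCtx-resp-≈C (suc c) p zero    = p zero
dropCtx-resp-≈C (suc c) p (suc y) = dropCtx-resp-≈C c (λ x → p (suc x)) y

dropCtx-⊕ : ∀ c Γ Δ y → dropCtx c (Γ ⊕ Δ) y ≡ (dropCtx c Γ ⊕ dropCtx c Δ) y
dropCtx-⊕ zero    Γ Δ y       = ≡.refl
dropCtx-⊕ (suc c) Γ Δ zero    = ≡.refl
dropCtx-⊕ (suc c) Γ Δ (suc y) = dropCtx-⊕ c (tail Γ) (tail Δ) y

dropCtx-∅ : ∀ c y → dropCtx c ∅ y ≡ []
dropCtx-∅ zero    y       = ≡.refl
dropCtx-∅ (suc c) zero    = ≡.refl
dropCtx-∅ (suc c) (suc y) = dropCtx-∅ c y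

dropCtx-⊕-interchange : ∀ c {Γ₁ Γ₂ Δ₁ Δ₂} → Γ ≈C (Γ₁ ⊕ Γ₂) → Δ ≈C (Δ₁ ⊕ Δ₂) → Δ′ ≈C (dropCtx c Γ₂ ⊕ Δ₂)
                      → (dropCtx c Γ ⊕ Δ) ≈C ((dropCtx c Γ₁ ⊕ Δ₁) ⊕ Δ′)
dropCtx-⊕-interchange {Γ} {Δ} {Δ′} c {Γ₁} {Γ₂} {Δ₁} {Δ₂} p q r = begin
  dropCtx c Γ ⊕ Δ                                   ≈⟨ ⊕-cong (dropCtx-resp-≈C c p) q ⟩
  dropCtx c (Γ₁ ⊕ Γ₂) ⊕ (Δ₁ ⊕ Δ₂)                   ≈⟨ ⊕-cong (≗⇒≈C (dropCtx-⊕ c Γ₁ Γ₂)) (≈C-refl {Δ₁ ⊕ Δ₂}) ⟩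
  (dropCtx c Γ₁ ⊕ dropCtx c Γ₂) ⊕ (Δ₁ ⊕ Δ₂)         ≈⟨ ⊕-interchange (dropCtx c Γ₁) (dropCtx c Γ₂) Δ₁ Δ₂ ⟩
  (dropCtx c Γ₁ ⊕ Δ₁) ⊕ (dropCtx c Γ₂ ⊕ Δ₂)         ≈⟨ ⊕-cong (≈C-refl {dropCtx c Γ₁ ⊕ Δ₁}) (≈C-sym r) ⟩
  (dropCtx c Γ₁ ⊕ Δ₁) ⊕ Δ′                          ∎
  where open ≈C-Reasoning

weaken : ℕ → Tm → Tm
weaken zero    u = u
weaken (suc c) u = rename suc (weaken c u)

substAt : ℕ → Tm → ℕ → Tm
substAt zero    u x       = subst0 u x
substAt (suc c) u zero    = var zero
substAt (suc c) u (suc x) = rename suc (substAt c u x)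

exts-substAt : ∀ {σ c u} → (∀ x → σ x ≡ substAt c u x) → ∀ x → exts σ x ≡ substAt (suc c) u x
exts-substAt σ≗ zero    = ≡.refl
exts-substAt σ≗ (suc x) = cong (rename suc) (σ≗ x)

substAt-self : ∀ c u → substAt c u c ≡ weaken c u
substAt-self zero    u = ≡.refl
substAt-self (suc c) u = cong (rename suc) (substAt-self c u)

single-self : ∀ c τ → single c τ c ≡ τ ∷ []
single-self zero    τ = ≡.refl
single-self (suc c) τ = single-self c τ

dropCtx-single-self : ∀ c τ y → dropCtx c (single c τ) y ≡ []
dropCtx-single-self zero    τ y       = ≡.refl
dropCtx-single-self (suc c) τ zero    = ≡.refl
dropCtx-single-self (suc c) τ (suc y) = dropCtx-single-self c τ y

-- In the miss case x′ is the position of x once slot c is dropped.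
data SubstAtView (c : ℕ) : ℕ → Set where
  hit  : SubstAtView c c
  miss : ∀ {x} x′ → (∀ u → substAt c u x ≡ var x′)
       → (∀ τ y → dropCtx c (single x τ) y ≡ single x′ τ y) → (∀ τ → single x τ c ≡ [])
       → SubstAtView c x

substAtView : ∀ c x → SubstAtView c x
substAtView zero    zero    = hit
substAtView zero    (suc x) = miss x (λ _ → ≡.refl) (λ _ _ → ≡.refl) (λ _ → ≡.refl)
substAtView (suc c) zero    = miss zero (λ _ → ≡.refl) drop (λ _ → ≡.refl)
  where
  drop : ∀ τ y → dropCtx (suc c) (single zero τ) y ≡ single zero τ y
  drop τ zero    = ≡.refl
  drop τ (suc y) = dropCtx-∅ c y
substAtView (suc c) (suc x) with substAtView c x
... | hit                  = hit
... | miss x′ substx dropx selfx = miss (suc x′) (λ u → cong (rename suc) (substx u)) drop selfx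
  where
  drop : ∀ τ y → dropCtx (suc c) (single (suc x) τ) y ≡ single (suc x′) τ y
  drop τ zero    = ≡.refl
  drop τ (suc y) = dropx τ y

Deriv-subst-hit : ∀ c → Γ ≈C single c τ → Args (weaken c u) M Δ m e s → M ≈M Γ c
                → Deriv (dropCtx c Γ ⊕ Δ) (weaken c u) τ m e s
Deriv-subst-hit {Γ} {τ} {Δ = Δ} c q us p
  with Args-resp-≈M us (↭-trans p (↭-trans (q c) (↭-reflexive (single-self c τ))))
... | _ , (_∷_ {Δ = D} d []) , r =
  Deriv-cast (≡.sym (+-identityʳ _)) (≡.sym (+-identityʳ _)) (≡.sym (+-identityʳ _))
    (Deriv-resp-≈C d (begin
      D                      ≈⟨ ⊕-identityʳ D ⟨
      D ⊕ ∅                  ≈⟨ r ⟩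
      Δ                      ≈⟨ ⊕-cong (≈C-sym dropΓ≈∅) (≈C-refl {Δ}) ⟩
      dropCtx c Γ ⊕ Δ        ∎))
  where
  open ≈C-Reasoning
  dropΓ≈∅ : dropCtx c Γ ≈C ∅
  dropΓ≈∅ = ≈C-trans (dropCtx-resp-≈C c q) (≗⇒≈C (dropCtx-single-self c τ))

Deriv-subst-miss : ∀ c {x x′} → Γ ≈C single x τ → (∀ y → dropCtx c (single x τ) y ≡ single x′ τ y)
                 → single x τ c ≡ [] → Args u M Δ m e s → M ≈M Γ c
                 → Deriv (dropCtx c Γ ⊕ Δ) (var x′) τ m e s
Deriv-subst-miss c q drop self us p with ≈M-[]-inv (↭-trans p (↭-trans (q c) (↭-reflexive self)))
Deriv-subst-miss c q drop self [] p | ≡.refl =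
  var-c (≈C-trans (⊕-identityʳ _) (≈C-trans (dropCtx-resp-≈C c q) (≗⇒≈C drop)))

+-interchange-split : ∀ m m′ m₁ m₂ {x} → x ≡ m₁ + m₂ → (m + m₁) + (m′ + m₂) ≡ (m + m′) + x
+-interchange-split m m′ m₁ m₂ ≡.refl = +-interchange m m₁ m′ m₂

mutual
  Deriv-subst : ∀ c u {σ} → (∀ x → σ x ≡ substAt c u x)
              → Deriv Γ t τ m e s → Args (weaken c u) M Δ m′ e′ s′ → M ≈M Γ c
              → Deriv (dropCtx c Γ ⊕ Δ) (subst σ t) τ (m + m′) (e + e′) (s + s′)
  Deriv-subst c u σ≗ (app-p d) us p = app-p (Deriv-subst c u σ≗ d us p)
  Deriv-subst c u σ≗ (abs-p {Γ = Γ₁} d tτ tM q) us p =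
    abs-p-≈ (Deriv-subst-body c u σ≗ d us (↭-trans p (q c))) tτ tM (++-identityʳ (Γ₁ 0))
      (⊕-cong (dropCtx-resp-≈C c q) ≈C-refl)
  Deriv-subst c u σ≗ (abs-c {Γ = Γ₁} d q) us p =
    abs-c-≈ (Deriv-subst-body c u σ≗ d us (↭-trans p (q c))) (++-identityʳ (Γ₁ 0))
      (⊕-cong (dropCtx-resp-≈C c q) ≈C-refl)
  Deriv-subst c u σ≗ (var-c {x = x} q) us p with substAtView c x
  ... | hit rewrite σ≗ c | substAt-self c u = Deriv-subst-hit c q us p
  ... | miss x′ substx dropx selfx rewrite σ≗ x | substx u =
    Deriv-subst-miss c {x} q (dropx _) (selfx _) us p
  Deriv-subst c u σ≗ (app-c {Γ = Γ₁} {m = m} {e = e} {s = s} {mᵢ = mᵢ} {eᵢ = eᵢ} {sᵢ = sᵢ} d as r q) us p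
    with Args-split-≈M (Γ₁ c) us (↭-trans p (q c))
  ... | argsSplit {m₁ = m₁} {e₁} {s₁} {m₂} {e₂} {s₂} us₁ us₂ q′ m≡ e≡ s≡
    with Args-subst c u σ≗ as us₂ (≈M-refl _)
  ... | _ , as′ , q″ =
    Deriv-cast (cong suc (+-interchange-split m mᵢ m₁ m₂ m≡))
               (cong suc (+-interchange-split e eᵢ e₁ e₂ e≡))
               (+-interchange-split s sᵢ s₁ s₂ s≡)
      (app-c (Deriv-subst c u σ≗ d us₁ (≈M-refl _)) as′ r (dropCtx-⊕-interchange c q q′ q″))
  Deriv-subst c u σ≗ (es-c {Γ = Γ₁} {m = m} {e = e} {s = s} {mᵢ = mᵢ} {eᵢ = eᵢ} {sᵢ = sᵢ} d as r q) us p
    with Args-split-≈M (Γ₁ (suc c)) us (↭-trans p (q c))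
  ... | argsSplit {m₁ = m₁} {e₁} {s₁} {m₂} {e₂} {s₂} us₁ us₂ q′ m≡ e≡ s≡
    with Args-subst c u σ≗ as us₂ (≈M-refl _)
  ... | _ , as′ , q″ =
    Deriv-cast (+-interchange-split m mᵢ m₁ m₂ m≡)
               (cong suc (+-interchange-split e eᵢ e₁ e₂ e≡))
               (+-interchange-split s sᵢ s₁ s₂ s≡)
      (es-c (Deriv-subst-body c u σ≗ d us₁ (≈M-refl _)) as′ (↭-trans r (↭-sym (++-identityʳ (Γ₁ 0))))
        (dropCtx-⊕-interchange c q q′ q″))

  Deriv-subst-body : ∀ c u {σ} → (∀ x → σ x ≡ substAt c u x)
                   → Deriv Γ t τ m e s → Args (weaken c u) M Δ m′ e′ s′ → M ≈M Γ (suc c)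
                   → Deriv (dropCtx (suc c) Γ ⊕ shiftCtx 1 Δ) (subst (exts σ) t) τ
                           (m + m′) (e + e′) (s + s′)
  Deriv-subst-body c u σ≗ d us p with Args-weaken 0 1 (λ _ → ≡.refl) us
  ... | _ , us′ , q = Deriv-resp-≈C (Deriv-subst (suc c) u (exts-substAt σ≗) d us′ p) (⊕-cong ≈C-refl q)

  Args-subst : ∀ c u {σ v N Δ₁} → (∀ x → σ x ≡ substAt c u x)
             → Args v N Δ₁ m e s → Args (weaken c u) M Δ m′ e′ s′ → M ≈M Δ₁ c
             → ArgsUpTo (subst σ v) N (dropCtx c Δ₁ ⊕ Δ) (m + m′) (e + e′) (s + s′)
  Args-subst c u σ≗ [] us p with ≈M-[]-inv p
  Args-subst c u σ≗ [] [] p | ≡.refl = ∅ , [] , ≗⇒≈C (λ y → ≡.sym (cong (_++ []) (dropCtx-∅ c y)))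
  Args-subst c u σ≗ (_∷_ {Δ = D} {m = m} {e = e} {s = s} {ms = ms} {es = es′} {ss = ss} d as) us p
    with Args-split-≈M (D c) us p
  ... | argsSplit {m₁ = m₁} {e₁} {s₁} {m₂} {e₂} {s₂} us₁ us₂ q m≡ e≡ s≡
    with Args-subst c u σ≗ as us₂ (≈M-refl _)
  ... | _ , as′ , q′ =
    _ , Args-cast (+-interchange-split m ms m₁ m₂ m≡)
                  (+-interchange-split e es′ e₁ e₂ e≡)
                  (+-interchange-split s ss s₁ s₂ s≡)
          (Deriv-subst c u σ≗ d us₁ (≈M-refl _) ∷ as′)
      , ≈C-sym (dropCtx-⊕-interchange c ≈C-refl q q′)

shiftCtx-suc : ∀ k E y → shiftCtx k (shiftCtx 1 E) y ≡ shiftCtx (suc k) E y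
shiftCtx-suc zero    E y       = ≡.refl
shiftCtx-suc (suc k) E zero    = ≡.refl
shiftCtx-suc (suc k) E (suc y) = shiftCtx-suc k E y

Deriv-dB : ∀ L {E} → Deriv Γ (L ⟨ ƛ t ⟩) (M ⇒ τ) m e s → Args u N Δ m′ e′ s′ → N ≈M M
         → Δ ≈C shiftCtx ∣ L ∣L E → Deriv (Γ ⊕ E) (L ⟨ es t u ⟩) τ (m + m′) (suc (e + e′)) (s + s′)
Deriv-dB □ (abs-c d q) as p r = es-c d as p (⊕-cong q (≈C-sym r))
Deriv-dB (L [ v ]) {E} (es-c {Γ = Γ₁} {Δ = Δ₁} {m = m} {e = e} {s = s} d as₁ p₁ q) as p r =
  Deriv-cast (+-rightComm m _ _) (cong (λ x → suc (suc x)) (+-rightComm e _ _)) (+-rightComm s _ _)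
    (es-c (Deriv-dB L d as p (≈C-trans r (≈C-sym (≗⇒≈C (shiftCtx-suc ∣ L ∣L E)))))
      as₁ (↭-trans p₁ (↭-sym (++-identityʳ (Γ₁ 0))))
      (≈C-trans (⊕-cong q (≈C-refl {E})) (⊕-rightComm (tail Γ₁) Δ₁ E)))

LCtx-abs-not-n : ∀ L → ¬ Deriv Γ (L ⟨ ƛ t ⟩) n m e s
LCtx-abs-not-n □         ()
LCtx-abs-not-n (L [ v ]) (es-c d _ _ _) = LCtx-abs-not-n L d

Counters-app : ∀ k {x y} → Counters k m e m′ e′
             → Counters k (suc (m + x)) (suc (e + y)) (suc (m′ + x)) (suc (e′ + y))
Counters-app mstep {x} {y} (m≡ , e≡) = cong (λ z → suc (z + x)) m≡ , cong (λ z → suc (z + y)) e≡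
Counters-app estep {x} {y} (e≡ , m≡) = cong (λ z → suc (z + y)) e≡ , cong (λ z → suc (z + x)) m≡

subject-reduction : ∀ {t′ k} → Deriv Γ t σ m e s → t ⟶[ k ] t′
                  → Σ ℕ λ m′ → Σ ℕ λ e′ → Deriv Γ t′ σ m′ e′ s × Counters k m e m′ e′
subject-reduction (app-p d) (dB L t u) = ⊥-elim (LCtx-abs-not-n L d)
subject-reduction (app-c d as p q) (dB L t u) with Args-weaken 0 ∣ L ∣L (λ _ → ≡.refl) as
... | _ , as′ , r = _ , _ , Deriv-resp-≈C (Deriv-dB L d as′ p r) (≈C-sym q) , ≡.refl , ≡.refl
subject-reduction (es-c d as p q) (sub t u) =
  _ , _ , Deriv-resp-≈C (Deriv-subst 0 u (λ _ → ≡.refl) d as p) (≈C-sym q) , ≡.refl , ≡.refl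
subject-reduction (app-p d) (appL u st _) with subject-reduction d st
... | _ , _ , d′ , c = _ , _ , app-p d′ , c
subject-reduction (app-c d as p q) (appL {k} u st _) with subject-reduction d st
... | _ , _ , d′ , c = _ , _ , app-c d′ as p q , Counters-app k c
subject-reduction (abs-p d tτ tM q) (lam st) with subject-reduction d st
... | _ , _ , d′ , c = _ , _ , abs-p d′ tτ tM q , c
subject-reduction (abs-c d q) (lam st) with subject-reduction d st
... | _ , _ , d′ , c = _ , _ , abs-c d′ q , c

lemma3p5 : ∀ {Γ t t′ σ m e s k}
    → Deriv Γ t σ m e s → TightCtx Γ → TightTy σ
    → t ⟶[ k ] t′
    → Σ ℕ λ m′ → Σ ℕ λ e′ → Deriv Γ t′ σ m′ e′ s × Counters k m e m′ e′
lemma3p5 d _ _ = subject-reduction d
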